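{- Let $X$ be an image-finite poset. If $\mathrm{Up}(X)\in\mathsf{DHA}$, then $X$ is a diamond system.
   Context: ${\uparrow}x=\{y:x\le y\}$; $X$ is image-finite if every ${\uparrow}x$ is finite. $\mathrm{Up}(X)$ is the Heyting algebra of upsets of $X$ ($U\to V=\{x:{\uparrow}x\cap U\subseteq V\}$). A poset satisfies the three point rule if for all distinct $x,y,z$, if $x,y$ are incomparable and $x\le z$ then $y\le z$. A poset $X$ is a diamond system if: (D1) each ${\uparrow}x$ satisfies the three point rule; (D2) no ${\uparrow}x$ contains a $3$-element antichain; (D3) for all $x$ and $y,z\in{\uparrow}x$ there is $w$ with $y,z\le w$; (D4) whenever $\bot\le x,y$, $x,y\le z,v$, $z,v\le\top$, there is $w$ with $x,y\le w\le z,v$. A diamond sequence is a diamond system in which any two elements have a common lower bound. $\mathsf{DHA}$ is the variety generated by $\{\mathrm{Up}(Y): Y$ a finite diamond sequence$\}$. -}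

module Defs where

open import Level using (0ℓ)
open import Data.Nat using (ℕ)
open import Data.Fin using (Fin)
open import Data.List using (List)
open import Data.List.Membership.Propositional using (_∈_)
open import Data.Product using (Σ; ∃; _×_; _,_; proj₁)
open import Data.Sum using (_⊎_)
open import Data.Empty using (⊥)
open import Data.Unit using (⊤)
open import Relation.Nullary using (¬_)
open import Relation.Binary.Core using (Rel)
open import Relation.Binary.Structures using (IsPartialOrder)
open import Relation.Binary.PropositionalEquality using (_≡_)
open import Function.Bundles using (_⇔_)

record PosetD : Set₁ where
  field
    Carrier : Set
    _≤_     : Rel Carrier 0ℓ
    isPartialOrder : IsPartialOrder _≡_ _≤_

record FinPoset (m : ℕ) : Set₁ where
  field
    _≤_ : Rel (Fin m) 0ℓ
    isPartialOrder : IsPartialOrder _≡_ _≤_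

toPosetD : ∀ {m} → FinPoset m → PosetD
toPosetD {m} Y = record
  { Carrier = Fin m ; _≤_ = FinPoset._≤_ Y
  ; isPartialOrder = FinPoset.isPartialOrder Y }

module _ (P : PosetD) where
  open PosetD P

  Incomparable : Carrier → Carrier → Set
  Incomparable x y = ¬ (x ≤ y) × ¬ (y ≤ x)

  ImageFinite : Set
  ImageFinite = ∀ x → Σ (List Carrier) λ l → ∀ y → (x ≤ y) ⇔ (y ∈ l)

  D1 : Set
  D1 = ∀ w x y z → w ≤ x → w ≤ y → w ≤ z →
       ¬ x ≡ y → ¬ x ≡ z → ¬ y ≡ z →
       Incomparable x y → x ≤ z → y ≤ z

  D2 : Set
  D2 = ∀ w x y z → w ≤ x → w ≤ y → w ≤ z →
       ¬ (Incomparable x y × Incomparable x z × Incomparable y z)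

  D3 : Set
  D3 = ∀ x y z → x ≤ y → x ≤ z → ∃ λ w → y ≤ w × z ≤ w

  D4 : Set
  D4 = ∀ bot x y z v top →
       bot ≤ x → bot ≤ y →
       x ≤ z → x ≤ v → y ≤ z → y ≤ v →
       z ≤ top → v ≤ top →
       ∃ λ w → x ≤ w × y ≤ w × w ≤ z × w ≤ v

  IsDiamondSystem : Set
  IsDiamondSystem = D1 × D2 × D3 × D4

  IsDiamondSequence : Set
  IsDiamondSequence = IsDiamondSystem × (∀ x y → ∃ λ z → z ≤ x × z ≤ y)

  IsUpset : (Carrier → Set) → Set
  IsUpset U = ∀ x y → x ≤ y → U x → U y

  Upset : Set₁
  Upset = Σ (Carrier → Set) IsUpset

data Term (n : ℕ) : Set where
  var  : Fin n → Term n
  top  : Term n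
  bot  : Term n
  _∧'_ : Term n → Term n → Term n
  _∨'_ : Term n → Term n → Term n
  _⇒'_ : Term n → Term n → Term n

module _ (P : PosetD) where
  open PosetD P

  ⟦_⟧ : ∀ {n} → Term n → (Fin n → Upset P) → Carrier → Set
  ⟦ var i ⟧  ρ x = proj₁ (ρ i) x
  ⟦ top ⟧    ρ x = ⊤
  ⟦ bot ⟧    ρ x = ⊥
  ⟦ t ∧' s ⟧ ρ x = ⟦ t ⟧ ρ x × ⟦ s ⟧ ρ x
  ⟦ t ∨' s ⟧ ρ x = ⟦ t ⟧ ρ x ⊎ ⟦ s ⟧ ρ x
  ⟦ t ⇒' s ⟧ ρ x = ∀ y → x ≤ y → ⟦ t ⟧ ρ y → ⟦ s ⟧ ρ y

  Satisfies : ∀ {n} → Term n → Term n → Set₁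
  Satisfies t s = ∀ (ρ : Fin _ → Upset P) x → ⟦ t ⟧ ρ x ⇔ ⟦ s ⟧ ρ x

ValidInDHA : ∀ {n} → Term n → Term n → Set₁
ValidInDHA t s = ∀ m (Y : FinPoset m) → IsDiamondSequence (toPosetD Y) →
                 Satisfies (toPosetD Y) t s

-- Up(X) ∈ DHA: Up(X) satisfies every equation valid in all generators of DHA
UpInDHA : PosetD → Set₁
UpInDHA X = ∀ n (t s : Term n) → ValidInDHA t s → Satisfies X t s

-- Each of (D1)–(D4) is the first-order correspondent of a Heyting equation φᵢ ≈ ⊤:
-- φᵢ is valid on Up(Y) whenever Y satisfies (Dᵢ), and conversely, evaluating φᵢ on
-- principal upsets (and, for (D4), on complements of principal downsets) shows that
-- validity of φᵢ on Up(X) forces (Dᵢ).  Finite diamond sequences satisfy (D1)–(D4),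
-- so the φᵢ ≈ ⊤ are equations of DHA and therefore hold in Up(X).
module Submission where

open import Defs
open import Level using (0ℓ)
open import Axiom.ExcludedMiddle using (ExcludedMiddle)
open import Data.Fin using (Fin; zero; suc)
open import Data.Product using (∃; _×_; _,_; proj₁; proj₂)
open import Data.Sum using (_⊎_; inj₁; inj₂; [_,_]′)
open import Data.Empty using (⊥; ⊥-elim)
open import Data.Unit using (tt)
open import Relation.Nullary using (¬_; yes; no)
open import Relation.Binary.PropositionalEquality using (sym; subst)
open import Relation.Binary.Structures using (IsPartialOrder)
open import Function.Base using (_∘_)
open import Function.Bundles using (mk⇔; Equivalence)

¬'_ : ∀ {n} → Term n → Term n
¬' t = t ⇒' bot

φ₁ : Term 3
φ₁ = (p ⇒' r) ∨' (r ⇒' ((q ⇒' p) ∨' (q ∨' p)))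
  where
  p q r : Term 3
  p = var zero
  q = var (suc zero)
  r = var (suc (suc zero))

φ₂ : Term 3
φ₂ = (a ⇒' (b ∨' c)) ∨' ((b ⇒' (a ∨' c)) ∨' (c ⇒' (a ∨' b)))
  where
  a b c : Term 3
  a = var zero
  b = var (suc zero)
  c = var (suc (suc zero))

φ₃ : Term 1
φ₃ = (¬' var zero) ∨' (¬' (¬' var zero))

φ₄ : Term 4
φ₄ = ((p ∧' q) ⇒' (a ∨' b)) ⇒'
     ((p ⇒' (q ∨' (a ∨' (b ∨' (((p ∧' q) ⇒' a) ∨' ((p ∧' q) ⇒' b)))))) ∨' (q ⇒' (a ∨' b)))
  where
  p q a b : Term 4
  p = var zero
  q = var (suc zero)
  a = var (suc (suc zero))
  b = var (suc (suc (suc zero)))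

_⊨_ : ∀ {n} → PosetD → Term n → Set₁
X ⊨ t = ∀ ρ x → ⟦_⟧ X t ρ x

UpInDHA⇒⊨ : ∀ {n} {X : PosetD} → UpInDHA X → (t : Term n) →
            (∀ m (Y : FinPoset m) → IsDiamondSystem (toPosetD Y) → toPosetD Y ⊨ t) →
            X ⊨ t
UpInDHA⇒⊨ {n} H t valid ρ x = Equivalence.from (H n t top validInDHA ρ x) tt
  where
  validInDHA : ValidInDHA t top
  validInDHA m Y (diamond , _) ρ y = mk⇔ (λ _ → tt) (λ _ → valid m Y diamond ρ y)

module Classical (em : ExcludedMiddle 0ℓ) where

  by-cases : ∀ {A B : Set} → (A → B) → (¬ A → B) → B
  by-cases {A} f g with em {A}
  ... | yes a = f a
  ... | no ¬a = g ¬a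

  by-contradiction : ∀ {A : Set} → ¬ ¬ A → A
  by-contradiction ¬¬a = by-cases (λ a → a) (λ ¬a → ⊥-elim (¬¬a ¬a))

  module _ (X : PosetD) where
    open PosetD X
    open IsPartialOrder isPartialOrder using (trans; antisym) renaming (refl to ≤-refl)

    ¬⇒-witness : ∀ {w} {A B : Carrier → Set} → ¬ (∀ y → w ≤ y → A y → B y) →
                 ∃ λ y → w ≤ y × A y × ¬ B y
    ¬⇒-witness h = by-contradiction λ none → h λ y w≤y ay →
      by-contradiction λ ¬by → none (y , w≤y , ay , ¬by)

    mono : ∀ {n} (ρ : Fin n → Upset X) i {a b} → a ≤ b → proj₁ (ρ i) a → proj₁ (ρ i) b
    mono ρ i {a} {b} = proj₂ (ρ i) a b

    principal : Carrier → Upset X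
    principal t = (t ≤_) , λ a b a≤b t≤a → trans t≤a a≤b

    outside-downset : Carrier → Upset X
    outside-downset t = (λ s → ¬ s ≤ t) , λ a b a≤b a≰t b≤t → a≰t (trans a≤b b≤t)

    D1⇒⊨φ₁ : D1 X → X ⊨ φ₁
    D1⇒⊨φ₁ d1 ρ w =
      by-cases inj₁ λ ¬p⇒r → by-cases inj₂ λ ¬r⇒ψ →
        let (y , w≤y , py , ¬ry) = ¬⇒-witness ¬p⇒r
            (x , w≤x , rx , ¬ψx) = ¬⇒-witness ¬r⇒ψ
            (z , x≤z , qz , ¬pz) = ¬⇒-witness (¬ψx ∘ inj₁)
            ¬qx = ¬ψx ∘ inj₂ ∘ inj₁
            ¬px = ¬ψx ∘ inj₂ ∘ inj₂
            y≤z = d1 w x y z w≤x w≤y (trans w≤x x≤z)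
              (λ x≡y → ¬ry (subst r x≡y rx)) (λ x≡z → ¬qx (subst q (sym x≡z) qz))
              (λ y≡z → ¬pz (subst p y≡z py))
              ((λ x≤y → ¬ry (mono ρ (suc (suc zero)) x≤y rx)) , (λ y≤x → ¬px (mono ρ zero y≤x py)))
              x≤z
        in ⊥-elim (¬pz (mono ρ zero y≤z py))
      where
      p q r : Carrier → Set
      p = proj₁ (ρ zero)
      q = proj₁ (ρ (suc zero))
      r = proj₁ (ρ (suc (suc zero)))

    ⊨φ₁⇒D1 : X ⊨ φ₁ → D1 X
    ⊨φ₁⇒D1 valid w x y z w≤x w≤y _ _ x≢z _ (x≰y , y≰x) x≤z = by-contradiction λ y≰z →
      [ (λ y⇒x → x≰y (y⇒x y w≤y ≤-refl))
      , (λ x⇒ψ → [ (λ z⇒y → y≰z (z⇒y z x≤z ≤-refl))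
                 , [ (λ z≤x → x≢z (antisym x≤z z≤x)) , y≰x ]′ ]′ (x⇒ψ x w≤x ≤-refl)) ]′
      (valid ρ w)
      where
      ρ : Fin 3 → Upset X
      ρ zero = principal y
      ρ (suc zero) = principal z
      ρ (suc (suc zero)) = principal x

    D2⇒⊨φ₂ : D2 X → X ⊨ φ₂
    D2⇒⊨φ₂ d2 ρ w =
      by-cases inj₁ λ ¬a⇒ → by-cases (inj₂ ∘ inj₁) λ ¬b⇒ → by-cases (inj₂ ∘ inj₂) λ ¬c⇒ →
        let (x , w≤x , ax , ¬x) = ¬⇒-witness ¬a⇒
            (y , w≤y , by , ¬y) = ¬⇒-witness ¬b⇒
            (z , w≤z , cz , ¬z) = ¬⇒-witness ¬c⇒
        in ⊥-elim (d2 w x y z w≤x w≤y w≤z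
          ( ((λ x≤y → ¬y (inj₁ (a↑ x≤y ax))) , (λ y≤x → ¬x (inj₁ (b↑ y≤x by))))
          , ((λ x≤z → ¬z (inj₁ (a↑ x≤z ax))) , (λ z≤x → ¬x (inj₂ (c↑ z≤x cz))))
          , ((λ y≤z → ¬z (inj₂ (b↑ y≤z by))) , (λ z≤y → ¬y (inj₂ (c↑ z≤y cz))))))
      where
      a↑ : ∀ {s t} → s ≤ t → proj₁ (ρ zero) s → proj₁ (ρ zero) t
      a↑ = mono ρ zero
      b↑ : ∀ {s t} → s ≤ t → proj₁ (ρ (suc zero)) s → proj₁ (ρ (suc zero)) t
      b↑ = mono ρ (suc zero)
      c↑ : ∀ {s t} → s ≤ t → proj₁ (ρ (suc (suc zero))) s → proj₁ (ρ (suc (suc zero))) t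
      c↑ = mono ρ (suc (suc zero))

    ⊨φ₂⇒D2 : X ⊨ φ₂ → D2 X
    ⊨φ₂⇒D2 valid w x y z w≤x w≤y w≤z ((x≰y , y≰x) , (x≰z , z≰x) , (y≰z , z≰y)) =
      [ (λ x⇒ → [ y≰x , z≰x ]′ (x⇒ x w≤x ≤-refl))
      , [ (λ y⇒ → [ x≰y , z≰y ]′ (y⇒ y w≤y ≤-refl))
        , (λ z⇒ → [ x≰z , y≰z ]′ (z⇒ z w≤z ≤-refl)) ]′ ]′
      (valid ρ w)
      where
      ρ : Fin 3 → Upset X
      ρ zero = principal x
      ρ (suc zero) = principal y
      ρ (suc (suc zero)) = principal z

    D3⇒⊨φ₃ : D3 X → X ⊨ φ₃
    D3⇒⊨φ₃ d3 ρ x = by-cases inj₁ λ ¬¬p →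
      let (y , x≤y , py , _) = ¬⇒-witness ¬¬p
      in inj₂ λ z x≤z ¬pz → let (w , y≤w , z≤w) = d3 x y z x≤y x≤z
                            in ¬pz w z≤w (mono ρ zero y≤w py)

    ⊨φ₃⇒D3 : X ⊨ φ₃ → D3 X
    ⊨φ₃⇒D3 valid x y z x≤y x≤z = by-contradiction λ no-bound →
      [ (λ ¬↑y → ¬↑y y x≤y ≤-refl)
      , (λ ¬¬↑y → ¬¬↑y z x≤z λ w z≤w y≤w → no-bound (w , y≤w , z≤w)) ]′
      (valid ρ x)
      where
      ρ : Fin 1 → Upset X
      ρ zero = principal y

    D1∧D3∧D4⇒⊨φ₄ : D1 X → D3 X → D4 X → X ⊨ φ₄
    D1∧D3∧D4⇒⊨φ₄ d1 d3 d4 ρ _ b₀ _ pq⇒ab =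
      by-cases inj₁ λ ¬p⇒ → by-cases inj₂ λ ¬q⇒ → ⊥-elim (refute (¬⇒-witness ¬p⇒) (¬⇒-witness ¬q⇒))
      where
      p q a b : Carrier → Set
      p = proj₁ (ρ zero)
      q = proj₁ (ρ (suc zero))
      a = proj₁ (ρ (suc (suc zero)))
      b = proj₁ (ρ (suc (suc (suc zero))))
      refute : (∃ λ x → b₀ ≤ x × p x × ¬ (q x ⊎ (a x ⊎ (b x ⊎
                 ((∀ t → x ≤ t → p t × q t → a t) ⊎ (∀ t → x ≤ t → p t × q t → b t)))))) →
               (∃ λ y → b₀ ≤ y × q y × ¬ (a y ⊎ b y)) → ⊥
      refute (x , b₀≤x , px , ¬φx) (y , b₀≤y , qy , ¬aby) =
        let (z , x≤z , (pz , qz) , ¬az) = ¬⇒-witness (¬φx ∘ inj₂ ∘ inj₂ ∘ inj₂ ∘ inj₁)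
            (v , x≤v , (pv , qv) , ¬bv) = ¬⇒-witness (¬φx ∘ inj₂ ∘ inj₂ ∘ inj₂ ∘ inj₂)
            (t , z≤t , v≤t) = d3 b₀ z v (trans b₀≤x x≤z) (trans b₀≤x x≤v)
            (w , x≤w , y≤w , w≤z , w≤v) =
              d4 b₀ x y z v t b₀≤x b₀≤y x≤z x≤v (below-pq x≤z pz qz) (below-pq x≤v pv qv) z≤t v≤t
        in [ (λ aw → ¬az (mono ρ (suc (suc zero)) w≤z aw))
           , (λ bw → ¬bv (mono ρ (suc (suc (suc zero))) w≤v bw)) ]′
           (pq⇒ab w (trans b₀≤x x≤w) (mono ρ zero x≤w px , mono ρ (suc zero) y≤w qy))
        where
        ¬qx : ¬ q x
        ¬qx = ¬φx ∘ inj₁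
        x#y : Incomparable X x y
        x#y = (λ x≤y → ¬aby (pq⇒ab y b₀≤y (mono ρ zero x≤y px , qy)))
            , (λ y≤x → ¬qx (mono ρ (suc zero) y≤x qy))
        below-pq : ∀ {t} → x ≤ t → p t → q t → y ≤ t
        below-pq {t} x≤t pt qt = d1 b₀ x y t b₀≤x b₀≤y (trans b₀≤x x≤t)
          (λ x≡y → proj₁ x#y (subst (x ≤_) x≡y ≤-refl)) (λ x≡t → ¬qx (subst q (sym x≡t) qt))
          (λ y≡t → ¬aby (pq⇒ab y b₀≤y (subst p (sym y≡t) pt , qy)))
          x#y x≤t

    ⊨φ₄⇒D4 : X ⊨ φ₄ → D4 X
    ⊨φ₄⇒D4 valid b₀ x y z v _ b₀≤x b₀≤y x≤z x≤v y≤z y≤v _ _ = by-contradiction λ no-middle →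
      let not-both : ∀ t → b₀ ≤ t → x ≤ t × y ≤ t → ¬ t ≤ z ⊎ ¬ t ≤ v
          not-both t _ (x≤t , y≤t) = by-cases
            (λ t≤z → by-cases (λ t≤v → ⊥-elim (no-middle (t , x≤t , y≤t , t≤z , t≤v))) inj₂) inj₁
      in [ (λ x⇒ → [ (λ y≤x → no-middle (x , ≤-refl , y≤x , x≤z , x≤v))
                   , [ (λ x≰z → x≰z x≤z)
                     , [ (λ x≰v → x≰v x≤v)
                       , [ (λ xy⇒z → xy⇒z z x≤z (x≤z , y≤z) ≤-refl)
                         , (λ xy⇒v → xy⇒v v x≤v (x≤v , y≤v) ≤-refl) ]′ ]′ ]′ ]′
                   (x⇒ x b₀≤x ≤-refl))
         , (λ y⇒ → [ (λ y≰z → y≰z y≤z) , (λ y≰v → y≰v y≤v) ]′ (y⇒ y b₀≤y ≤-refl)) ]′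
         (valid ρ b₀ b₀ ≤-refl not-both)
      where
      ρ : Fin 4 → Upset X
      ρ zero = principal x
      ρ (suc zero) = principal y
      ρ (suc (suc zero)) = outside-downset z
      ρ (suc (suc (suc zero))) = outside-downset v

corollary4p6 : ExcludedMiddle 0ℓ → (X : PosetD) →
    ImageFinite X → UpInDHA X → IsDiamondSystem X
corollary4p6 em X _ H =
    ⊨φ₁⇒D1 X (UpInDHA⇒⊨ H φ₁ λ _ Y (d1 , _) → D1⇒⊨φ₁ (toPosetD Y) d1)
  , ⊨φ₂⇒D2 X (UpInDHA⇒⊨ H φ₂ λ _ Y (_ , d2 , _) → D2⇒⊨φ₂ (toPosetD Y) d2)
  , ⊨φ₃⇒D3 X (UpInDHA⇒⊨ H φ₃ λ _ Y (_ , _ , d3 , _) → D3⇒⊨φ₃ (toPosetD Y) d3)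
  , ⊨φ₄⇒D4 X (UpInDHA⇒⊨ H φ₄ λ _ Y (d1 , _ , d3 , d4) → D1∧D3∧D4⇒⊨φ₄ (toPosetD Y) d1 d3 d4)
  where open Classical em
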